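{- Let $G$ be an additive group of order $g$, let $q=\lambda n+1$ be a prime power, and let $\Sigma$ be a $(G,K,\lambda)$-SDF admitting a good lifting $\mathcal L$ to $G\times\mathbb F_q$. Then there exists a $(G\times\mathbb F_q,\,G\times\{0\},\,\underline{n}K,\,1)$-DF, and this DF is resolvable if $\Sigma$ is harmonious and $\mathcal L$ is perfect.
   Context: For a multiset $B=\{b_1,\dots,b_k\}$ in an additive group, $\Delta B=\{b_i-b_j\mid i\ne j\}$ (multiset); for a collection $\mathcal F$, $\Delta\mathcal F$ is the multiset union of the $\Delta B$ and the flatten of $\mathcal F$ is the multiset union of its members. A $(G,H,K,\lambda)$-DF is a collection $\mathcal F$ of multisets in $G$ ($H\le G$) with $\Delta\mathcal F$ equal to $\lambda$ copies of $G\setminus H$, $K$ being the multiset of block sizes; it is resolvable (when $\lambda=1$) if its flatten is a complete system of representatives of the non-trivial left cosets of $H$. A $(G,K,\lambda)$-SDF (strong difference family) is a collection $\Sigma$ of multisets in $G$ with multiset of sizes $K$ such that $\Delta\Sigma$ is $\lambda$ copies of all of $G$ (including $0$); it is harmonious if the sum of its block sizes equals $\lambda$. $\underline{n}K$ denotes the multiset union of $n$ copies of $K$. A lifting of $\Sigma$ to $G\times\mathbb F_q$ ($q\equiv1\pmod\lambda$) replaces each block $B=\{b_1,\dots,b_k\}$ by $\ell(B)=\{(b_1,c_1),\dots,(b_k,c_k)\}$ with $c_i\in\mathbb F_q$; with $\mathcal L=\{\ell(B)\mid B\in\Sigma\}$ one has $\Delta\mathcal L=\bigcup_{x\in G}\{x\}\times\Delta_x$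 where each $\Delta_x$ is a multiset of $\lambda$ elements of $\mathbb F_q$. A subset $S\subseteq\mathbb F_q$ of size $(q-1)/\lambda$ is a good companion for $\mathcal L$ if, for every $x\in G$, the multiset $S\cdot\Delta_x=\{sd\mid s\in S,d\in\Delta_x\}$ equals $\mathbb F_q^*$ (each element once); $\mathcal L$ is a good lifting if it has a good companion. If $\Sigma$ is harmonious, let $\pi(\mathcal L)$ be the multiset of second coordinates of all elements of all blocks of $\mathcal L$; a good companion $S$ with $S\cdot\pi(\mathcal L)=\mathbb F_q^*$ is a perfect companion, and $\mathcal L$ is then a perfect lifting. -}

module Defs where

open import Data.Nat using (ℕ; zero; suc; _^_; _≤_)
open import Data.Nat.Primality using (Prime)
open import Data.Fin using (Fin)
open import Data.List using (List; []; _∷_; map; _++_; concat; concatMap; length; filter)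
open import Data.Nat.ListAction using (sum)
open import Data.List.Relation.Binary.Permutation.Propositional using (_↭_)
open import Data.List.Relation.Unary.Unique.Propositional using (Unique)
open import Data.Product using (_×_; _,_; proj₁; proj₂; Σ; ∃; ∃-syntax)
open import Data.Bool using (if_then_else_)
open import Relation.Binary.PropositionalEquality using (_≡_; _≢_; refl)
open import Relation.Binary.Definitions using (DecidableEquality)
open import Relation.Nullary using (yes; no; does)
open import Relation.Unary using (Pred; Decidable)
open import Level using (0ℓ)
open import Function.Bundles using (_↔_)
open import Algebra.Core using (Op₁; Op₂)
import Algebra.Structures as AS

-- Multisets are lists; multiplicity of x in a list

occ : {A : Set} → DecidableEquality A → A → List A → ℕ
occ _≟_ x [] = 0
occ _≟_ x (y ∷ ys) with y ≟ x
... | yes _ = suc (occ _≟_ x ys)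
... | no _  = occ _≟_ x ys

-- ΔB = multiset { b_i - b_j | i ≠ j } (all ordered pairs of distinct positions)
Δ : {A : Set} → Op₂ A → List A → List A
Δ _-_ [] = []
Δ _-_ (b ∷ bs) = map (b -_) bs ++ map (_- b) bs ++ Δ _-_ bs

ΔF : {A : Set} → Op₂ A → List (List A) → List A
ΔF _-_ = concatMap (Δ _-_)

flatten : {A : Set} → List (List A) → List A
flatten = concat

record FinGroup : Set₁ where
  field
    Carrier : Set
    _+_     : Op₂ Carrier
    0#      : Carrier
    -_      : Op₁ Carrier
    isGroup : AS.IsGroup {A = Carrier} _≡_ _+_ 0# -_
    _≟_     : DecidableEquality Carrier
    order   : ℕ
    enum    : Fin order ↔ Carrier
  infixl 6 _+_
  infix  8 -_
  _-_ : Op₂ Carrier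
  x - y = x + (- y)

record FiniteField : Set₁ where
  field
    Carrier    : Set
    _+_ _*_    : Op₂ Carrier
    -_         : Op₁ Carrier
    0# 1#      : Carrier
    isCommutativeRing : AS.IsCommutativeRing {A = Carrier} _≡_ _+_ _*_ -_ 0# 1#
    0≢1        : 0# ≢ 1#
    inverse    : ∀ x → x ≢ 0# → ∃[ y ] (x * y ≡ 1#)
    _≟_        : DecidableEquality Carrier
    size       : ℕ
    enum       : Fin size ↔ Carrier
  infixl 6 _+_
  infixl 7 _*_
  infix  8 -_
  _-_ : Op₂ Carrier
  x - y = x + (- y)

IsPrimePower : ℕ → Set
IsPrimePower q = ∃[ p ] ∃[ k ] (Prime p × 1 ≤ k × q ≡ p ^ k)

module _ {A : Set} (_≟_ : DecidableEquality A) (_+_ : Op₂ A) (-_ : Op₁ A)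
         {H : Pred A 0ℓ} (H? : Decidable H) where

  private
    _-_ : Op₂ A
    x - y = x + (- y)

  record IsDF (F : List (List A)) (K : List ℕ) (lam : ℕ) : Set where
    field
      sizes : map length F ↭ K
      diffs : ∀ x → occ _≟_ x (ΔF _-_ F) ≡ (if does (H? x) then 0 else lam)

  -- flatten F is a complete system of representatives of the non-trivial
  -- left cosets y+H of H: every coset y+H with y ∉ H contains exactly one
  -- element of flatten F (counted with multiplicity), and H itself none.
  -- (z ∈ y + H  iff  (- y) + z ∈ H.)
  IsResolvable : List (List A) → Set
  IsResolvable F = ∀ y →
    length (filter (λ z → H? ((- y) + z)) (flatten F)) ≡ (if does (H? y) then 0 else 1)

module _ (G : FinGroup) where
  open FinGroup G

  record IsSDF (Σ' : List (List Carrier)) (K : List ℕ) (lam : ℕ) : Set where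
    field
      sizes : map length Σ' ↭ K
      diffs : ∀ x → occ _≟_ x (ΔF _-_ Σ') ≡ lam

  IsHarmonious : List (List Carrier) → ℕ → Set
  IsHarmonious Σ' lam = sum (map length Σ') ≡ lam

module _ (G : FinGroup) (Fq : FiniteField) where
  private
    module G = FinGroup G
    module F = FiniteField Fq

  GF : Set
  GF = G.Carrier × F.Carrier

  _≟GF_ : DecidableEquality GF
  (a , c) ≟GF (b , d) with a G.≟ b | c F.≟ d
  ... | yes refl | yes refl = yes refl
  ... | no ¬p    | _        = no (λ { refl → ¬p refl })
  ... | yes _    | no ¬q    = no (λ { refl → ¬q refl })

  _+GF_ : Op₂ GF
  (a , c) +GF (b , d) = (a G.+ b , c F.+ d)

  -GF_ : Op₁ GF
  -GF (a , c) = (G.- a , F.- c)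

  _-GF_ : Op₂ GF
  x -GF y = x +GF (-GF y)

  InH : Pred GF 0ℓ
  InH (a , c) = c ≡ F.0#

  InH? : Decidable InH
  InH? (a , c) = c F.≟ F.0#

  IsLifting : List (List G.Carrier) → List (List GF) → Set
  IsLifting Σ' L = map (map proj₁) L ≡ Σ'

  Δ[_]_ : List (List GF) → G.Carrier → List F.Carrier
  Δ[ L ] x = map proj₂ (filter (λ p → proj₁ p G.≟ x) (ΔF _-GF_ L))

  _·_ : List F.Carrier → List F.Carrier → List F.Carrier
  S · D = concatMap (λ s → map (s F.*_) D) S

  IsFqStar : List F.Carrier → Set
  IsFqStar xs = ∀ y → occ F._≟_ y xs ≡ (if does (y F.≟ F.0#) then 0 else 1)

  -- S ⊆ F_q with |S| = n (= (q-1)/λ) is a good companion for L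
  IsGoodCompanion : ℕ → List (List GF) → List F.Carrier → Set
  IsGoodCompanion n L S = Unique S × length S ≡ n × (∀ x → IsFqStar (S · (Δ[ L ] x)))

  IsGoodLifting : ℕ → List (List GF) → Set
  IsGoodLifting n L = ∃[ S ] IsGoodCompanion n L S

  π : List (List GF) → List F.Carrier
  π L = map proj₂ (flatten L)

  IsPerfectLifting : ℕ → List (List GF) → Set
  IsPerfectLifting n L = ∃[ S ] (IsGoodCompanion n L S × IsFqStar (S · π L))

-- Let S be a good companion and put D = { s·ℓ(B) | s ∈ S, B ∈ Σ }, where
-- s·(g , c) = (g , s c). This scaling is an endomorphism of G × F_q fixing
-- first coordinates, so the differences of D lying over x ∈ G have second
-- coordinates S·Δ_x = F_q^*: every element of G × F_q^* occurs once and none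
-- of G × {0} does, i.e. D is a DF with block sizes n copies of K. Likewise the
-- second coordinates of the flatten of D form S·π(L), so a perfect companion
-- makes D resolvable. As D must be chosen before knowing whether L is perfect,
-- this is decided by searching the finitely many words of length n over F_q,
-- and S is taken perfect whenever possible.
module Submission where

open import Defs
open import Data.Nat using (ℕ; zero; suc; _+_; _*_)
import Data.Nat as ℕ
open import Data.Fin using (Fin)
import Data.Fin.Properties as Fin
open import Data.Bool using (if_then_else_)
open import Data.List using (List; []; _∷_; [_]; concat; replicate; map; _++_; concatMap; length; filter; allFin; cartesianProductWith)
open import Data.List.Properties using (map-++; map-∘; map-cong; length-map; concat-map; concat-++; concatMap-++; filter-accept; filter-reject)
open import Data.List.Relation.Binary.Permutation.Propositional using (_↭_; ↭-refl)
open import Data.List.Relation.Binary.Permutation.Propositional.Properties using (++⁺)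
open import Data.List.Relation.Unary.All using (All; []; _∷_)
import Data.List.Relation.Unary.All as All
open import Data.List.Relation.Unary.Any using (any?; satisfied)
import Data.List.Relation.Unary.Any as Any
open import Data.List.Membership.Propositional using (_∈_)
open import Data.List.Membership.Propositional.Properties using (∈-map⁺; ∈-allFin; ∈-cartesianProductWith⁺)
open import Data.List.Relation.Unary.Unique.DecPropositional using (unique?)
open import Data.Empty using (⊥-elim)
open import Data.Product using (_×_; _,_; proj₁; proj₂; ∃-syntax)
open import Function using (_∘_; _↔_; Inverse)
open import Relation.Binary.PropositionalEquality using (_≡_; _≢_; refl; sym; trans; cong; cong₂; subst; module ≡-Reasoning)
open import Relation.Binary.Definitions using (DecidableEquality)
open import Relation.Nullary using (Dec; yes; no; does)
open import Relation.Nullary.Decidable using (_×-dec_)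
open import Relation.Unary using (Pred; Decidable)
open import Level using (0ℓ)
open import Algebra.Core using (Op₁; Op₂)
open import Algebra.Bundles using (CommutativeRing; Ring)
import Algebra.Properties.Ring as RingProperties
import Algebra.Properties.Group as GroupProperties

module _ {A : Set} (_≟_ : DecidableEquality A) where

  occ-here : ∀ {x y} ys → y ≡ x → occ _≟_ x (y ∷ ys) ≡ suc (occ _≟_ x ys)
  occ-here {x} {y} ys y≡x with y ≟ x
  ... | yes _   = refl
  ... | no y≢x  = ⊥-elim (y≢x y≡x)

  occ-there : ∀ {x y} ys → y ≢ x → occ _≟_ x (y ∷ ys) ≡ occ _≟_ x ys
  occ-there {x} {y} ys y≢x with y ≟ x
  ... | yes y≡x = ⊥-elim (y≢x y≡x)
  ... | no _    = refl

  occ-++ : ∀ x xs ys → occ _≟_ x (xs ++ ys) ≡ occ _≟_ x xs + occ _≟_ x ys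
  occ-++ x []       ys = refl
  occ-++ x (y ∷ xs) ys with y ≟ x
  ... | yes _ = cong suc (occ-++ x xs ys)
  ... | no _  = occ-++ x xs ys

occ-pair : {A B : Set} (_≟ᴬ_ : DecidableEquality A) (_≟ᴮ_ : DecidableEquality B)
           (_≟_ : DecidableEquality (A × B)) (g : A) (y : B) (ps : List (A × B)) →
           occ _≟_ (g , y) ps ≡ occ _≟ᴮ_ y (map proj₂ (filter (λ p → proj₁ p ≟ᴬ g) ps))
occ-pair _≟ᴬ_ _≟ᴮ_ _≟_ g y [] = refl
occ-pair _≟ᴬ_ _≟ᴮ_ _≟_ g y ((a , b) ∷ ps) = by-cases (a ≟ᴬ g) (b ≟ᴮ y)
  where
  open ≡-Reasoning
  over-g : (p : _ × _) → Dec (proj₁ p ≡ g)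
  over-g p = proj₁ p ≟ᴬ g
  seconds-over-g : List (_ × _) → ℕ
  seconds-over-g qs = occ _≟ᴮ_ y (map proj₂ (filter over-g qs))
  IH : occ _≟_ (g , y) ps ≡ seconds-over-g ps
  IH = occ-pair _≟ᴬ_ _≟ᴮ_ _≟_ g y ps

  by-cases : Dec (a ≡ g) → Dec (b ≡ y) → occ _≟_ (g , y) ((a , b) ∷ ps) ≡ seconds-over-g ((a , b) ∷ ps)
  by-cases (no a≢g) _ = begin
    occ _≟_ (g , y) ((a , b) ∷ ps)  ≡⟨ occ-there _≟_ ps (a≢g ∘ cong proj₁) ⟩
    occ _≟_ (g , y) ps              ≡⟨ IH ⟩
    seconds-over-g ps               ≡⟨ cong (occ _≟ᴮ_ y ∘ map proj₂) (filter-reject over-g a≢g) ⟨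
    seconds-over-g ((a , b) ∷ ps)   ∎
  by-cases (yes a≡g) (yes b≡y) = begin
    occ _≟_ (g , y) ((a , b) ∷ ps)                  ≡⟨ occ-here _≟_ ps (cong₂ _,_ a≡g b≡y) ⟩
    suc (occ _≟_ (g , y) ps)                        ≡⟨ cong suc IH ⟩
    suc (seconds-over-g ps)                         ≡⟨ occ-here _≟ᴮ_ _ b≡y ⟨
    occ _≟ᴮ_ y (b ∷ map proj₂ (filter over-g ps))   ≡⟨ cong (occ _≟ᴮ_ y ∘ map proj₂) (filter-accept over-g a≡g) ⟨
    seconds-over-g ((a , b) ∷ ps)                   ∎
  by-cases (yes a≡g) (no b≢y) = begin
    occ _≟_ (g , y) ((a , b) ∷ ps)                  ≡⟨ occ-there _≟_ ps (b≢y ∘ cong proj₂) ⟩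
    occ _≟_ (g , y) ps                              ≡⟨ IH ⟩
    seconds-over-g ps                               ≡⟨ occ-there _≟ᴮ_ _ b≢y ⟨
    occ _≟ᴮ_ y (b ∷ map proj₂ (filter over-g ps))   ≡⟨ cong (occ _≟ᴮ_ y ∘ map proj₂) (filter-accept over-g a≡g) ⟨
    seconds-over-g ((a , b) ∷ ps)                   ∎

ΔF-++ : {A : Set} (_-_ : Op₂ A) (F F′ : List (List A)) → ΔF _-_ (F ++ F′) ≡ ΔF _-_ F ++ ΔF _-_ F′
ΔF-++ _-_ = concatMap-++ (Δ _-_)

module _ {A B : Set} {_-_ : Op₂ A} {_-′_ : Op₂ B} (f : A → B)
         (f-sub : ∀ x y → f (x - y) ≡ f x -′ f y) where

  Δ-map : ∀ bs → Δ _-′_ (map f bs) ≡ map f (Δ _-_ bs)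
  Δ-map []       = refl
  Δ-map (b ∷ bs) = begin
    map (f b -′_) (map f bs) ++ map (_-′ f b) (map f bs) ++ Δ _-′_ (map f bs)
      ≡⟨ cong₂ _++_ (map-sub (f-sub b)) (cong₂ _++_ (map-sub (λ x → f-sub x b)) (Δ-map bs)) ⟩
    map f (map (b -_) bs) ++ map f (map (_- b) bs) ++ map f (Δ _-_ bs)
      ≡⟨ cong (map f (map (b -_) bs) ++_) (map-++ f (map (_- b) bs) (Δ _-_ bs)) ⟨
    map f (map (b -_) bs) ++ map f (map (_- b) bs ++ Δ _-_ bs)
      ≡⟨ map-++ f (map (b -_) bs) _ ⟨
    map f (Δ _-_ (b ∷ bs)) ∎
    where
    open ≡-Reasoning
    map-sub : {h : A → A} {h′ : B → B} → (∀ x → f (h x) ≡ h′ (f x)) → map h′ (map f bs) ≡ map f (map h bs)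
    map-sub {h} {h′} comm = trans (sym (map-∘ bs)) (trans (map-cong (sym ∘ comm) bs) (map-∘ bs))

  ΔF-map : ∀ F → ΔF _-′_ (map (map f) F) ≡ map f (ΔF _-_ F)
  ΔF-map []      = refl
  ΔF-map (B ∷ F) = trans (cong₂ _++_ (Δ-map B) (ΔF-map F)) (sym (map-++ f (Δ _-_ B) (ΔF _-_ F)))

map-length-map-map : {A B : Set} (f : A → B) (F : List (List A)) → map length (map (map f) F) ≡ map length F
map-length-map-map f F = trans (sym (map-∘ F)) (map-cong (length-map f) F)

concat-replicate⁺ : ∀ n {xs ys : List ℕ} → xs ↭ ys → concat (replicate n xs) ↭ concat (replicate n ys)
concat-replicate⁺ zero    _  = ↭-refl
concat-replicate⁺ (suc n) xs↭ys = ++⁺ xs↭ys (concat-replicate⁺ n xs↭ys)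

words : {A : Set} → ℕ → List A → List (List A)
words zero    xs = [ [] ]
words (suc n) xs = cartesianProductWith _∷_ xs (words n xs)

∈-words : {A : Set} {xs ws : List A} → All (_∈ xs) ws → ws ∈ words (length ws) xs
∈-words []           = Any.here refl
∈-words (w∈ ∷ ws∈)   = ∈-cartesianProductWith⁺ _∷_ w∈ (∈-words ws∈)

all?-↔ : {A : Set} {m : ℕ} {P : Pred A 0ℓ} → Fin m ↔ A → (∀ x → Dec (P x)) → Dec (∀ x → P x)
all?-↔ {P = P} e P? with Fin.all? (P? ∘ Inverse.to e)
... | yes ∀P = yes (λ x → subst P (Inverse.strictlyInverseˡ e x) (∀P (Inverse.from e x)))
... | no ¬∀P = no (λ ∀P → ¬∀P (∀P ∘ Inverse.to e))

enumeration : {A : Set} {m : ℕ} → Fin m ↔ A → List A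
enumeration {m = m} e = map (Inverse.to e) (allFin m)

∈-enumeration : {A : Set} {m : ℕ} (e : Fin m ↔ A) (x : A) → x ∈ enumeration e
∈-enumeration e x = subst (_∈ enumeration e) (Inverse.strictlyInverseˡ e x) (∈-map⁺ (Inverse.to e) (∈-allFin (Inverse.from e x)))

∃-of-length? : {A : Set} {P : Pred (List A) 0ℓ} (xs : List A) → (∀ x → x ∈ xs) → (n : ℕ) →
                  Decidable P → (∀ {ws} → P ws → length ws ≡ n) → Dec (∃[ ws ] P ws)
∃-of-length? {P = P} xs complete n P? length≡n with any? P? (words n xs)
... | yes some = yes (satisfied some)
... | no none  = no λ (ws , Pws) → none (Any.map (λ ws≡ → subst P ws≡ Pws) (ws∈words Pws))
  where
  ws∈words : ∀ {ws} → P ws → ws ∈ words n xs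
  ws∈words {ws} Pws = subst (λ k → ws ∈ words k xs) (length≡n Pws) (∈-words (All.tabulate (λ {x} _ → complete x)))

module _ (G : FinGroup) (Fq : FiniteField) where
  private
    module G = FinGroup G
    module F = FiniteField Fq
    _≟ₚ_ : DecidableEquality (GF G Fq)
    _≟ₚ_ = _≟GF_ G Fq
    _+ₚ_ _-ₚ_ : Op₂ (GF G Fq)
    _+ₚ_ = _+GF_ G Fq
    _-ₚ_ = _-GF_ G Fq
    -ₚ_ : Op₁ (GF G Fq)
    -ₚ_ = -GF_ G Fq
    over : (g : G.Carrier) (p : GF G Fq) → Dec (proj₁ p ≡ g)
    over g p = proj₁ p G.≟ g

  fieldRing : Ring 0ℓ 0ℓ
  fieldRing = CommutativeRing.ring (record
    { Carrier = F.Carrier ; _≈_ = _≡_ ; _+_ = F._+_ ; _*_ = F._*_ ; -_ = F.-_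
    ; 0# = F.0# ; 1# = F.1# ; isCommutativeRing = F.isCommutativeRing })

  open Ring fieldRing using (distribˡ; -‿inverseˡ)
  open RingProperties fieldRing using (-‿distribʳ-*)
  open GroupProperties (Ring.+-group fieldRing) using (inverseʳ-unique; ⁻¹-involutive)

  scale : F.Carrier → GF G Fq → GF G Fq
  scale s (g , c) = (g , s F.* c)

  scale-sub : ∀ s x y → scale s (x -ₚ y) ≡ scale s x -ₚ scale s y
  scale-sub s (a , c) (b , d) = cong (a G.- b ,_) (begin
    s F.* (c F.- d)               ≡⟨ distribˡ s c (F.- d) ⟩
    s F.* c F.+ s F.* (F.- d)     ≡⟨ cong (s F.* c F.+_) (sym (-‿distribʳ-* s d)) ⟩
    (s F.* c) F.- (s F.* d)       ∎)
    where open ≡-Reasoning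

  scaledCopies : List (List (GF G Fq)) → List F.Carrier → List (List (GF G Fq))
  scaledCopies L S = concatMap (λ s → map (map (scale s)) L) S

  proj₂-map-scale : ∀ s ps → map proj₂ (map (scale s) ps) ≡ map (s F.*_) (map proj₂ ps)
  proj₂-map-scale s ps = trans (sym (map-∘ ps)) (map-∘ ps)

  filter-over-map-scale : ∀ g s ps → filter (over g) (map (scale s) ps) ≡ map (scale s) (filter (over g) ps)
  filter-over-map-scale g s []             = refl
  filter-over-map-scale g s ((a , c) ∷ ps) with a G.≟ g
  ... | yes _ = cong ((a , s F.* c) ∷_) (filter-over-map-scale g s ps)
  ... | no _  = filter-over-map-scale g s ps

  occ-map-scale : ∀ g y s ps →
    occ _≟ₚ_ (g , y) (map (scale s) ps) ≡ occ F._≟_ y (map (s F.*_) (map proj₂ (filter (over g) ps)))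
  occ-map-scale g y s ps = begin
    occ _≟ₚ_ (g , y) (map (scale s) ps)                                 ≡⟨ occ-pair G._≟_ F._≟_ _≟ₚ_ g y (map (scale s) ps) ⟩
    occ F._≟_ y (map proj₂ (filter (over g) (map (scale s) ps)))        ≡⟨ cong (occ F._≟_ y ∘ map proj₂) (filter-over-map-scale g s ps) ⟩
    occ F._≟_ y (map proj₂ (map (scale s) (filter (over g) ps)))        ≡⟨ cong (occ F._≟_ y) (proj₂-map-scale s (filter (over g) ps)) ⟩
    occ F._≟_ y (map (s F.*_) (map proj₂ (filter (over g) ps)))         ∎
    where open ≡-Reasoning

  occ-ΔF-scaledCopies : ∀ L S g y →
    occ _≟ₚ_ (g , y) (ΔF _-ₚ_ (scaledCopies L S)) ≡ occ F._≟_ y (_·_ G Fq S (Δ[_]_ G Fq L g))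
  occ-ΔF-scaledCopies L []      g y = refl
  occ-ΔF-scaledCopies L (s ∷ S) g y = begin
    occ _≟ₚ_ (g , y) (ΔF _-ₚ_ (sL ++ scaledCopies L S))
      ≡⟨ cong (occ _≟ₚ_ (g , y)) (ΔF-++ _-ₚ_ sL (scaledCopies L S)) ⟩
    occ _≟ₚ_ (g , y) (ΔF _-ₚ_ sL ++ ΔF _-ₚ_ (scaledCopies L S))
      ≡⟨ occ-++ _≟ₚ_ (g , y) (ΔF _-ₚ_ sL) _ ⟩
    occ _≟ₚ_ (g , y) (ΔF _-ₚ_ sL) + occ _≟ₚ_ (g , y) (ΔF _-ₚ_ (scaledCopies L S))
      ≡⟨ cong₂ _+_ (trans (cong (occ _≟ₚ_ (g , y)) (ΔF-map (scale s) (scale-sub s) L)) (occ-map-scale g y s (ΔF _-ₚ_ L)))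
                   (occ-ΔF-scaledCopies L S g y) ⟩
    occ F._≟_ y (map (s F.*_) (Δ[_]_ G Fq L g)) + occ F._≟_ y (_·_ G Fq S (Δ[_]_ G Fq L g))
      ≡⟨ occ-++ F._≟_ y (map (s F.*_) (Δ[_]_ G Fq L g)) _ ⟨
    occ F._≟_ y (_·_ G Fq (s ∷ S) (Δ[_]_ G Fq L g)) ∎
    where
    open ≡-Reasoning
    sL : List (List (GF G Fq))
    sL = map (map (scale s)) L

  map-length-scaledCopies : ∀ L S → map length (scaledCopies L S) ≡ concat (replicate (length S) (map length L))
  map-length-scaledCopies L []      = refl
  map-length-scaledCopies L (s ∷ S) =
    trans (map-++ length (map (map (scale s)) L) (scaledCopies L S))
          (cong₂ _++_ (map-length-map-map (scale s) L) (map-length-scaledCopies L S))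

  scaledCopies-isDF : ∀ {n L S K} → map length L ↭ K → IsGoodCompanion G Fq n L S →
                      IsDF _≟ₚ_ _+ₚ_ -ₚ_ (InH? G Fq) (scaledCopies L S) (concat (replicate n K)) 1
  scaledCopies-isDF {L = L} {S} {K} L↭K (_ , |S|≡n , good) = record
    { sizes = subst (λ m → map length (scaledCopies L S) ↭ concat (replicate m K)) |S|≡n
                (subst (_↭ concat (replicate (length S) K)) (sym (map-length-scaledCopies L S))
                  (concat-replicate⁺ (length S) L↭K))
    ; diffs = λ (g , y) → trans (occ-ΔF-scaledCopies L S g y) (good g y)
    }

  coset-count : ∀ g c zs → length (filter (λ z → InH? G Fq ((-ₚ (g , c)) +ₚ z)) zs) ≡ occ F._≟_ c (map proj₂ zs)
  coset-count g c []             = refl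
  coset-count g c ((a , d) ∷ zs) = by-cases (d F.≟ c)
    where
    in-coset : (z : GF G Fq) → Dec (InH G Fq ((-ₚ (g , c)) +ₚ z))
    in-coset z = InH? G Fq ((-ₚ (g , c)) +ₚ z)
    IH : length (filter in-coset zs) ≡ occ F._≟_ c (map proj₂ zs)
    IH = coset-count g c zs

    by-cases : Dec (d ≡ c) → length (filter in-coset ((a , d) ∷ zs)) ≡ occ F._≟_ c (d ∷ map proj₂ zs)
    by-cases (yes refl) = trans (cong length (filter-accept in-coset (-‿inverseˡ d)))
                                (trans (cong suc IH) (sym (occ-here F._≟_ _ refl)))
    by-cases (no d≢c)   = trans (cong length (filter-reject in-coset (d≢c ∘ cancel)))
                                (trans IH (sym (occ-there F._≟_ _ d≢c)))
      where
      cancel : (F.- c) F.+ d ≡ F.0# → d ≡ c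
      cancel e = trans (inverseʳ-unique (F.- c) d e) (⁻¹-involutive c)

  proj₂-flatten-scaledCopies : ∀ L S → map proj₂ (flatten (scaledCopies L S)) ≡ _·_ G Fq S (π G Fq L)
  proj₂-flatten-scaledCopies L []      = refl
  proj₂-flatten-scaledCopies L (s ∷ S) = begin
    map proj₂ (concat (sL ++ scaledCopies L S))
      ≡⟨ cong (map proj₂) (concat-++ sL (scaledCopies L S)) ⟨
    map proj₂ (concat sL ++ concat (scaledCopies L S))
      ≡⟨ map-++ proj₂ (concat sL) _ ⟩
    map proj₂ (concat sL) ++ map proj₂ (concat (scaledCopies L S))
      ≡⟨ cong₂ _++_ (trans (cong (map proj₂) (concat-map L)) (proj₂-map-scale s (concat L)))
                    (proj₂-flatten-scaledCopies L S) ⟩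
    map (s F.*_) (π G Fq L) ++ _·_ G Fq S (π G Fq L) ∎
    where
    open ≡-Reasoning
    sL : List (List (GF G Fq))
    sL = map (map (scale s)) L

  scaledCopies-isResolvable : ∀ L S → IsFqStar G Fq (_·_ G Fq S (π G Fq L)) →
                              IsResolvable _≟ₚ_ _+ₚ_ -ₚ_ (InH? G Fq) (scaledCopies L S)
  scaledCopies-isResolvable L S perfect (g , c) =
    trans (coset-count g c (flatten (scaledCopies L S)))
          (trans (cong (occ F._≟_ c) (proj₂-flatten-scaledCopies L S)) (perfect c))

  isFqStar? : ∀ xs → Dec (IsFqStar G Fq xs)
  isFqStar? xs = all?-↔ F.enum (λ y → occ F._≟_ y xs ℕ.≟ (if does (y F.≟ F.0#) then 0 else 1))

  isPerfectCompanion? : ∀ n L S → Dec (IsGoodCompanion G Fq n L S × IsFqStar G Fq (_·_ G Fq S (π G Fq L)))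
  isPerfectCompanion? n L S =
    (unique? F._≟_ S ×-dec length S ℕ.≟ n ×-dec all?-↔ G.enum (λ x → isFqStar? (_·_ G Fq S (Δ[_]_ G Fq L x))))
    ×-dec isFqStar? (_·_ G Fq S (π G Fq L))

  isPerfectLifting? : ∀ n L → Dec (IsPerfectLifting G Fq n L)
  isPerfectLifting? n L = ∃-of-length? (enumeration F.enum) (∈-enumeration F.enum) n
                            (isPerfectCompanion? n L) (proj₁ ∘ proj₂ ∘ proj₁)

  lifting-sizes : ∀ {Σ' L K} → IsLifting G Fq Σ' L → map length Σ' ↭ K → map length L ↭ K
  lifting-sizes {Σ'} {L} {K} lifting =
    subst (_↭ K) (trans (sym (cong (map length) lifting)) (map-length-map-map proj₁ L))

theorem3p7 : (G : FinGroup) (Fq : FiniteField) (lam n : ℕ)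
    → FiniteField.size Fq ≡ lam * n + 1
    → IsPrimePower (FiniteField.size Fq)
    → (Σ' : List (List (FinGroup.Carrier G))) (K : List ℕ)
    → IsSDF G Σ' K lam
    → (L : List (List (GF G Fq)))
    → IsLifting G Fq Σ' L
    → IsGoodLifting G Fq n L
    → ∃[ D ] (IsDF (_≟GF_ G Fq) (_+GF_ G Fq) (-GF_ G Fq) (InH? G Fq) D (concat (replicate n K)) 1
              × (IsHarmonious G Σ' lam → IsPerfectLifting G Fq n L
                  → IsResolvable (_≟GF_ G Fq) (_+GF_ G Fq) (-GF_ G Fq) (InH? G Fq) D))
theorem3p7 G Fq lam n _ _ Σ' K sdf L lifting (S , good) with isPerfectLifting? G Fq n L
... | yes (T , goodT , perfectT) =
  scaledCopies G Fq L T , scaledCopies-isDF G Fq L↭K goodT , λ _ _ → scaledCopies-isResolvable G Fq L T perfectT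
  where
  L↭K : map length L ↭ K
  L↭K = lifting-sizes G Fq lifting (IsSDF.sizes sdf)
... | no notPerfect =
  scaledCopies G Fq L S , scaledCopies-isDF G Fq L↭K good , λ _ perfect → ⊥-elim (notPerfect perfect)
  where
  L↭K : map length L ↭ K
  L↭K = lifting-sizes G Fq lifting (IsSDF.sizes sdf)
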